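{- Let $n\geq2$. Then 1. $a_{1,2}(2n)=b_{1,2}(2n)=b_{2,2}(2n-1)$; 2. $a_{2,1}(2n)=c_{1,1}(2n)=c_{2,1}(2n-1)$; 3. $a_{2,2}(2n)=a_{1,2}(2n+1)=c_{1,2}(2n)=b_{2,2}(2n)$; 4. $a_{1,1}(2n+1)=b_{1,1}(2n+1)=b_{2,1}(2n)$; 5. $a_{2,1}(2n+1)=a_{1,1}(2n+2)=b_{2,1}(2n+1)=c_{1,1}(2n+1)$; 6. $a_{2,2}(2n+1)=c_{1,2}(2n+1)=c_{2,2}(2n)$.
   Context: Let $\mathcal{A}=\{\mathtt{A},\dots,\mathtt{P}\}$. The substitution $\mu$ maps each letter to a $2\times2$ block over $\mathcal{A}$ (written (first row / second row)): $\mathtt{A}\mapsto(\mathtt{AF}/\mathtt{GC})$, $\mathtt{B}\mapsto(\mathtt{AF}/\mathtt{HD})$, $\mathtt{C}\mapsto(\mathtt{BE}/\mathtt{GC})$, $\mathtt{D}\mapsto(\mathtt{BE}/\mathtt{HD})$, $\mathtt{E}\mapsto(\mathtt{AN}/\mathtt{GK})$, $\mathtt{F}\mapsto(\mathtt{AN}/\mathtt{HL})$, $\mathtt{G}\mapsto(\mathtt{BM}/\mathtt{GK})$, $\mathtt{H}\mapsto(\mathtt{BM}/\mathtt{HL})$, $\mathtt{I}\mapsto(\mathtt{IF}/\mathtt{OC})$, $\mathtt{J}\mapsto(\mathtt{IF}/\mathtt{PD})$, $\mathtt{K}\mapsto(\mathtt{JE}/\mathtt{OC})$, $\mathtt{L}\mapsto(\mathtt{JE}/\mathtt{PD})$,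 $\mathtt{M}\mapsto(\mathtt{IN}/\mathtt{OK})$, $\mathtt{N}\mapsto(\mathtt{IN}/\mathtt{PL})$, $\mathtt{O}\mapsto(\mathtt{JM}/\mathtt{OK})$, $\mathtt{P}\mapsto(\mathtt{JM}/\mathtt{PL})$. For a matrix $X$ over $\mathcal{A}$, $\mu(X)$ replaces each entry by its $2\times2$ block; $\mu^0=\mathrm{id}$, $\mu^k=\mu^{k-1}\circ\mu$; $T_k:=\mu^k(\mathtt{N})$. For a matrix $X$, $X[r,c,m\times n]$ is its $m\times n$ contiguous submatrix with upper-left corner at row $r$, column $c$; $P(X,m\times n)$ is the set of all its $m\times n$ contiguous submatrices; $P(T,m\times n):=\bigcup_{k\ge0}P(T_k,m\times n)$. For $i,j\in\{1,2\}$, $P_{i,j}(T,m\times n):=\{\mu(x)[i,j,m\times n]: x\in P(T,m\times n)\}$. Define $a_{i,j}(n):=|P_{i,j}(T,n\times n)|$, $b_{i,j}(n):=|P_{i,j}(T,n\times(n+1))|$, $c_{i,j}(n):=|P_{i,j}(T,(n+1)\times n)|$. -}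

module Defs where

open import Data.Nat using (ℕ; zero; suc; _+_; _*_; _∸_; _^_; _≤_)
open import Data.List using (List; []; _∷_; map; take; drop; length; concatMap; _++_)
open import Data.List.Relation.Unary.All using (All)
open import Data.List.Relation.Unary.Unique.Propositional using (Unique)
open import Data.List.Membership.Propositional using (_∈_)
open import Data.Product using (Σ; ∃; _×_; _,_)
open import Function.Bundles using (_⇔_)
open import Relation.Binary.PropositionalEquality using (_≡_)

data Letter : Set where
  A B C D E F G H I J K L M N O P : Letter

Matrix : Set
Matrix = List (List Letter)

top bot : Letter → List Letter
top A = A ∷ F ∷ []
top B = A ∷ F ∷ []
top C = B ∷ E ∷ []
top D = B ∷ E ∷ []
top E = A ∷ N ∷ []
top F = A ∷ N ∷ []
top G = B ∷ M ∷ []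
top H = B ∷ M ∷ []
top I = I ∷ F ∷ []
top J = I ∷ F ∷ []
top K = J ∷ E ∷ []
top L = J ∷ E ∷ []
top M = I ∷ N ∷ []
top N = I ∷ N ∷ []
top O = J ∷ M ∷ []
top P = J ∷ M ∷ []
bot A = G ∷ C ∷ []
bot B = H ∷ D ∷ []
bot C = G ∷ C ∷ []
bot D = H ∷ D ∷ []
bot E = G ∷ K ∷ []
bot F = H ∷ L ∷ []
bot G = G ∷ K ∷ []
bot H = H ∷ L ∷ []
bot I = O ∷ C ∷ []
bot J = P ∷ D ∷ []
bot K = O ∷ C ∷ []
bot L = P ∷ D ∷ []
bot M = O ∷ K ∷ []
bot N = P ∷ L ∷ []
bot O = O ∷ K ∷ []
bot P = P ∷ L ∷ []

μ : Matrix → Matrix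
μ [] = []
μ (row ∷ rows) = concatMap top row ∷ concatMap bot row ∷ μ rows

μ^ : ℕ → Matrix → Matrix
μ^ zero X = X
μ^ (suc k) X = μ^ k (μ X)

T : ℕ → Matrix
T k = μ^ k ((N ∷ []) ∷ [])

-- X[r,c,m×n] with 0-indexed corner (r, c)  (paper's 1-indexed corner is (r+1, c+1))
sub : (r c m n : ℕ) → Matrix → Matrix
sub r c m n X = map (λ row → take n (drop c row)) (take m (drop r X))

InPT : (m n : ℕ) → Matrix → Set
InPT m n x = Σ ℕ λ k → Σ ℕ λ r → Σ ℕ λ c →
  (r + m ≤ 2 ^ k) × (c + n ≤ 2 ^ k) × (x ≡ sub r c m n (T k))

-- z ∈ P_{i,j}(T, m×n) for i, j ∈ {1,2} (1-indexed, as in the paper)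
InPij : (i j m n : ℕ) → Matrix → Set
InPij i j m n z = Σ Matrix λ x → InPT m n x × (z ≡ sub (i ∸ 1) (j ∸ 1) m n (μ x))

HasCard : (Matrix → Set) → ℕ → Set
HasCard S k = Σ (List Matrix) λ xs →
  Unique xs × (length xs ≡ k) × (∀ y → (y ∈ xs) ⇔ S y)

-- sets whose cardinalities are a_{i,j}(n), b_{i,j}(n), c_{i,j}(n)
𝔞 𝔟 𝔠 : (i j n : ℕ) → Matrix → Set
𝔞 i j n = InPij i j n n
𝔟 i j n = InPij i j n (suc n)
𝔠 i j n = InPij i j (suc n) n

SameCard : List (Matrix → Set) → Set₁
SameCard Ss = Σ ℕ λ k → All (λ S → HasCard S k) Ss

-- Write T_k(x, y) for the letter of T_k = μ^k(N) at (x, y). Then T_{k+1}(2r + i, 2c + j) is the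
-- (i, j) entry of μ(T_k(r, c)), so P_{i+1,j+1}(T, m×n) consists of the m×n windows of T_{k+1} at
-- (2r + i, 2c + j) with r + m, c + n ≤ 2^k.
-- In T_{k+2} a letter in an odd column y + 2 is a fixed function of the letters at columns y + 1 and y,
-- and a letter in an even row x is a fixed function of the letters at rows x + 1 and x + 2. Hence
-- deleting the last column of a window (when that column is odd) or its first row (when that row is
-- even) is injective on these sets. It is also surjective, because every window of T_k reappears inside
-- T_{k+3} with room to extend it. Each of the six chains is a sequence of such deletions starting from
-- one set, and that set is finite because every m×n window already occurs in T_{m+n+5}: it lies in a
-- 2×2 block of supertiles of level m + n, and every 2×2 block of T occurs in T₅.

module Submission where

open import Data.Empty using (⊥-elim)
open import Data.List
  using (List; []; _∷_; map; take; drop; length; concatMap; applyUpTo; upTo; cartesianProduct; filter; deduplicate)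
import Data.List.Properties as List
open import Data.List.Properties using (map-applyUpTo; length-map; ∷-injectiveˡ; ∷-injectiveʳ)
open import Data.List.Membership.Propositional using (_∈_; find)
open import Data.List.Membership.Propositional.Properties
  using (∈-map⁺; ∈-map⁻; ∈-filter⁺; ∈-filter⁻; ∈-cartesianProduct⁺; ∈-upTo⁺; ∈-deduplicate⁺; ∈-deduplicate⁻)
open import Data.List.Relation.Unary.All as All using (All; []; _∷_; all?)
open import Data.List.Relation.Unary.All.Properties using () renaming (map⁺ to All-map⁺)
open import Data.List.Relation.Unary.Any using (Any; any?)
open import Data.List.Relation.Unary.AllPairs using ([]; _∷_)
open import Data.List.Relation.Unary.Unique.Propositional using (Unique)
open import Data.List.Relation.Unary.Unique.DecPropositional.Properties using (deduplicate-!)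
open import Data.Nat using (ℕ; zero; suc; _+_; _*_; _∸_; _^_; _≤_; _<_; _≤?_; z≤n; s≤s; s≤s⁻¹; ⌊_/2⌋; parity)
open import Data.Nat.Properties
  using (+-assoc; +-comm; +-suc; +-identityʳ; *-assoc; *-comm; *-identityˡ; *-identityʳ; *-distribʳ-+;
         ≤-refl; ≤-trans; <-≤-trans; ≤-<-trans; <⇒≤; ≰⇒>; 1+n≰n; n<1⇒n≡0;
         n<1+n; n≤1+n; m<n⇒m<1+n; m<1+n⇒m<n∨m≡n;
         m≤m+n; m≤n+m; m+n∸m≡n; m+[n∸m]≡n; m≤n⇒∃[o]m+o≡n; ∸-monoˡ-≤;
         +-monoˡ-≤; +-monoʳ-≤; +-mono-≤; +-monoʳ-<; *-monoˡ-≤; *-monoʳ-≤; +-cancelˡ-≤; +-cancelʳ-≤;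
         m^n>0; ^-monoʳ-≤; ^-distribˡ-+-*; ⌊n/2⌋-mono; ⌊n/2⌋<n; module ≤-Reasoning)
open import Data.Nat.Tactic.RingSolver using (solve-∀)
open import Data.Parity.Base using (Parity; 0ℙ; 1ℙ; _⁻¹)
open import Data.Parity.Properties using (suc-homo-⁻¹; ⁻¹-selfInverse; *-homo-*) renaming (_≟_ to _≟ᴾ_)
open import Data.Product using (Σ; _×_; _,_; proj₁; proj₂)
open import Data.Product.Properties using (≡-dec)
open import Data.Sum using (inj₁; inj₂)
open import Function.Base using (_∘_)
open import Function.Bundles using (_⇔_; mk⇔; Equivalence)
open import Relation.Binary.Definitions using (DecidableEquality)
open import Relation.Binary.PropositionalEquality using (_≡_; refl; cong; cong₂; sym; trans; subst; module ≡-Reasoning)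
open import Relation.Nullary using (Dec; yes; no; _×-dec_)
open import Relation.Nullary.Decidable using (map′; from-yes)

open import Defs

private variable
  Elem Elem′ : Set

drop-applyUpTo : ∀ (f : ℕ → Elem) r n → drop r (applyUpTo f n) ≡ applyUpTo (λ i → f (r + i)) (n ∸ r)
drop-applyUpTo f zero    n       = refl
drop-applyUpTo f (suc r) zero    = refl
drop-applyUpTo f (suc r) (suc n) = drop-applyUpTo (λ i → f (suc i)) r n

take-applyUpTo : ∀ (f : ℕ → Elem) {m n} → m ≤ n → take m (applyUpTo f n) ≡ applyUpTo f m
take-applyUpTo f z≤n       = refl
take-applyUpTo f (s≤s m≤n) = cong (f 0 ∷_) (take-applyUpTo (λ i → f (suc i)) m≤n)

applyUpTo-cong : ∀ {f g : ℕ → Elem} n → (∀ {i} → i < n → f i ≡ g i) → applyUpTo f n ≡ applyUpTo g n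
applyUpTo-cong zero    f≗g = refl
applyUpTo-cong (suc n) f≗g = cong₂ _∷_ (f≗g (s≤s z≤n)) (applyUpTo-cong n (λ i<n → f≗g (s≤s i<n)))

applyUpTo-injective : ∀ {f g : ℕ → Elem} {n i} → applyUpTo f n ≡ applyUpTo g n → i < n → f i ≡ g i
applyUpTo-injective {n = suc n} {zero}  eq (s≤s _)   = ∷-injectiveˡ eq
applyUpTo-injective {n = suc n} {suc i} eq (s≤s i<n) = applyUpTo-injective (∷-injectiveʳ eq) i<n

Unique-map-on : ∀ {S : Elem → Set} (φ : Elem → Elem′) → (∀ {z z′} → S z → S z′ → φ z ≡ φ z′ → z ≡ z′) →
  ∀ {zs} → All S zs → Unique zs → Unique (map φ zs)
Unique-map-on φ inj []         []          = []
Unique-map-on φ inj (sz ∷ szs) (z∉zs ∷ u) =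
  All-map⁺ (All.zipWith (λ (z≢z′ , sz′) φz≡φz′ → z≢z′ (inj sz sz′ φz≡φz′)) (z∉zs , szs)) ∷
  Unique-map-on φ inj szs u

r+m≤n⇒m≤n∸r : ∀ {r m n} → r + m ≤ n → m ≤ n ∸ r
r+m≤n⇒m≤n∸r {r} {m} r+m≤n = subst (_≤ _) (m+n∸m≡n r m) (∸-monoˡ-≤ r r+m≤n)

⌊m*2+n/2⌋≡m+⌊n/2⌋ : ∀ m n → ⌊ m * 2 + n /2⌋ ≡ m + ⌊ n /2⌋
⌊m*2+n/2⌋≡m+⌊n/2⌋ zero    n = refl
⌊m*2+n/2⌋≡m+⌊n/2⌋ (suc m) n = cong suc (⌊m*2+n/2⌋≡m+⌊n/2⌋ m n)

parity[m*2+n]≡parity[n] : ∀ m n → parity (m * 2 + n) ≡ parity n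
parity[m*2+n]≡parity[n] zero    n = refl
parity[m*2+n]≡parity[n] (suc m) n = parity[m*2+n]≡parity[n] m n

parity[1+n]≡parity[n]⁻¹ : ∀ n → parity (suc n) ≡ parity n ⁻¹
parity[1+n]≡parity[n]⁻¹ n = sym (⁻¹-selfInverse (suc-homo-⁻¹ n))

parity[1+n]≡1ℙ : ∀ n → parity n ≡ 0ℙ → parity (suc n) ≡ 1ℙ
parity[1+n]≡1ℙ n even = trans (parity[1+n]≡parity[n]⁻¹ n) (cong _⁻¹ even)

parity[n]≡1ℙ : ∀ n → parity (suc n) ≡ 0ℙ → parity n ≡ 1ℙ
parity[n]≡1ℙ n even = trans (sym (suc-homo-⁻¹ n)) (cong _⁻¹ even)

⌊1+n/2⌋≡1+⌊n/2⌋ : ∀ {n} → parity n ≡ 1ℙ → ⌊ suc n /2⌋ ≡ suc ⌊ n /2⌋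
⌊1+n/2⌋≡1+⌊n/2⌋ {suc zero}    _   = refl
⌊1+n/2⌋≡1+⌊n/2⌋ {suc (suc n)} odd = cong suc (⌊1+n/2⌋≡1+⌊n/2⌋ {n} odd)

⌊1+n/2⌋≡⌊n/2⌋ : ∀ {n} → parity n ≡ 0ℙ → ⌊ suc n /2⌋ ≡ ⌊ n /2⌋
⌊1+n/2⌋≡⌊n/2⌋ {zero}        _    = refl
⌊1+n/2⌋≡⌊n/2⌋ {suc (suc n)} even = cong suc (⌊1+n/2⌋≡⌊n/2⌋ {n} even)

⌊n/2⌋<m : ∀ {m n} → n < m * 2 → ⌊ n /2⌋ < m
⌊n/2⌋<m {suc m} {zero}        _                = s≤s z≤n
⌊n/2⌋<m {suc m} {suc zero}    _                = s≤s z≤n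
⌊n/2⌋<m {suc m} {suc (suc n)} (s≤s (s≤s n<m*2)) = s≤s (⌊n/2⌋<m n<m*2)

⌊i+a/2⌋<m : ∀ {i a m} → i ≤ 1 → a < m → ⌊ i + a /2⌋ < m
⌊i+a/2⌋<m {i} {a} i≤1 a<m = ≤-<-trans (⌊n/2⌋-mono (+-monoˡ-≤ a i≤1)) (<-≤-trans (⌊n/2⌋<n a) a<m)

⌊s+a/2⌋≤1 : ∀ {s a} → s ≤ 2 → a ≤ 1 → ⌊ s + a /2⌋ ≤ 1
⌊s+a/2⌋≤1 s≤2 a≤1 = s≤s⁻¹ (⌊n/2⌋<m {2} (s≤s (+-mono-≤ s≤2 a≤1)))

i+m≤m*2 : ∀ {i m} → i ≤ 1 → 1 ≤ m → i + m ≤ m * 2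
i+m≤m*2 {i} {m} i≤1 1≤m =
  subst (i + m ≤_) (trans (cong (m +_) (sym (+-identityʳ m))) (*-comm 2 m)) (+-monoˡ-≤ m (≤-trans i≤1 1≤m))

⌊_/2^_⌋ : ℕ → ℕ → ℕ
⌊ u /2^ zero  ⌋ = u
⌊ u /2^ suc j ⌋ = ⌊ ⌊ u /2⌋ /2^ j ⌋

m*2^[1+n]≡m*2^n*2 : ∀ m n → m * 2 ^ suc n ≡ m * 2 ^ n * 2
m*2^[1+n]≡m*2^n*2 m n = trans (cong (m *_) (*-comm 2 (2 ^ n))) (sym (*-assoc m (2 ^ n) 2))

⌊u/2^j⌋<t : ∀ {t} j {u} → u < t * 2 ^ j → ⌊ u /2^ j ⌋ < t
⌊u/2^j⌋<t {t} zero    u<t   = subst (_ <_) (*-identityʳ t) u<t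
⌊u/2^j⌋<t {t} (suc j) {u} u<t*2^j = ⌊u/2^j⌋<t j (⌊n/2⌋<m (subst (u <_) (m*2^[1+n]≡m*2^n*2 t j) u<t*2^j))

⌊u/2^j⌋≡0 : ∀ j {u} → u < 2 ^ j → ⌊ u /2^ j ⌋ ≡ 0
⌊u/2^j⌋≡0 j {u} u<2^j = n<1⇒n≡0 (⌊u/2^j⌋<t j (subst (u <_) (sym (*-identityˡ (2 ^ j))) u<2^j))

n<2^n : ∀ n → n < 2 ^ n
n<2^n zero    = s≤s z≤n
n<2^n (suc n) = subst (suc (suc n) ≤_) (cong (2 ^ n +_) (sym (+-identityʳ (2 ^ n)))) (+-mono-≤ (m^n>0 2 n) (n<2^n n))

split-into-blocks : ∀ b t {r m} → m ≤ b → 2 ≤ t → r + m ≤ t * b →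
  Σ ℕ λ p → Σ ℕ λ u → (r ≡ p * b + u) × (u + m ≤ 2 * b) × (p + 2 ≤ t)
split-into-blocks b t {r} {m} m≤b 2≤t r+m≤tb with r + m ≤? 2 * b
... | yes r+m≤2b = 0 , r , refl , r+m≤2b , 2≤t
split-into-blocks b 1 _ (s≤s ()) _ | no _
split-into-blocks b 2 _ _ r+m≤tb | no r+m≰2b = ⊥-elim (r+m≰2b r+m≤tb)
split-into-blocks b (suc t@(suc (suc _))) {r} {m} m≤b _ r+m≤tb | no r+m≰2b =
  let p , u , r∸b≡pb+u , u+m≤2b , p+2≤t = split-into-blocks b t {r ∸ b} m≤b (s≤s (s≤s z≤n)) r∸b+m≤tb
  in  suc p , u ,
      trans (sym (m+[n∸m]≡n b≤r)) (trans (cong (b +_) r∸b≡pb+u) (sym (+-assoc b (p * b) u))) ,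
      u+m≤2b , s≤s p+2≤t
  where
  b≤r : b ≤ r
  b≤r = +-cancelʳ-≤ b b r (begin
    b + b        ≡⟨ cong (b +_) (+-identityʳ b) ⟨
    2 * b        <⟨ ≰⇒> r+m≰2b ⟩
    r + m        ≤⟨ +-monoʳ-≤ r m≤b ⟩
    r + b        ∎)
    where open ≤-Reasoning
  r∸b+m≤tb : r ∸ b + m ≤ t * b
  r∸b+m≤tb = +-cancelˡ-≤ b _ _ (begin
    b + (r ∸ b + m)  ≡⟨ +-assoc b (r ∸ b) m ⟨
    b + (r ∸ b) + m  ≡⟨ cong (_+ m) (m+[n∸m]≡n b≤r) ⟩
    r + m            ≤⟨ r+m≤tb ⟩
    b + t * b        ∎)
    where open ≤-Reasoning

block-fits : ∀ j t {p u m} → p + 2 ≤ 2 ^ t → u + m ≤ 2 * 2 ^ j → p * 2 ^ j + u + m ≤ 2 ^ (j + t)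
block-fits j t {p} {u} {m} p+2≤2^t u+m≤ = begin
  p * 2 ^ j + u + m          ≡⟨ +-assoc (p * 2 ^ j) u m ⟩
  p * 2 ^ j + (u + m)        ≤⟨ +-monoʳ-≤ (p * 2 ^ j) u+m≤ ⟩
  p * 2 ^ j + 2 * 2 ^ j      ≡⟨ *-distribʳ-+ (2 ^ j) p 2 ⟨
  (p + 2) * 2 ^ j            ≤⟨ *-monoˡ-≤ (2 ^ j) p+2≤2^t ⟩
  2 ^ t * 2 ^ j              ≡⟨ *-comm (2 ^ t) (2 ^ j) ⟩
  2 ^ j * 2 ^ t              ≡⟨ ^-distribˡ-+-* 2 j t ⟨
  2 ^ (j + t)                ∎
  where open ≤-Reasoning

-- Letters as bit vectors

-- The (ρ, γ) child of any
-- letter has second bit ρ + γ and third bit ρ, so in T_{k+1} the letter at (x, y) has second bit the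
-- parity of x + y and third bit the parity of x; the local rules below rest on this.
Bits : Set
Bits = Parity × Parity × Parity × Parity

encode : Letter → Bits
encode A = 0ℙ , 0ℙ , 0ℙ , 0ℙ
encode B = 0ℙ , 0ℙ , 0ℙ , 1ℙ
encode C = 0ℙ , 0ℙ , 1ℙ , 0ℙ
encode D = 0ℙ , 0ℙ , 1ℙ , 1ℙ
encode E = 0ℙ , 1ℙ , 0ℙ , 0ℙ
encode F = 0ℙ , 1ℙ , 0ℙ , 1ℙ
encode G = 0ℙ , 1ℙ , 1ℙ , 0ℙ
encode H = 0ℙ , 1ℙ , 1ℙ , 1ℙ
encode I = 1ℙ , 0ℙ , 0ℙ , 0ℙ
encode J = 1ℙ , 0ℙ , 0ℙ , 1ℙ
encode K = 1ℙ , 0ℙ , 1ℙ , 0ℙ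
encode L = 1ℙ , 0ℙ , 1ℙ , 1ℙ
encode M = 1ℙ , 1ℙ , 0ℙ , 0ℙ
encode N = 1ℙ , 1ℙ , 0ℙ , 1ℙ
encode O = 1ℙ , 1ℙ , 1ℙ , 0ℙ
encode P = 1ℙ , 1ℙ , 1ℙ , 1ℙ

decode : Bits → Letter
decode (0ℙ , 0ℙ , 0ℙ , 0ℙ) = A
decode (0ℙ , 0ℙ , 0ℙ , 1ℙ) = B
decode (0ℙ , 0ℙ , 1ℙ , 0ℙ) = C
decode (0ℙ , 0ℙ , 1ℙ , 1ℙ) = D
decode (0ℙ , 1ℙ , 0ℙ , 0ℙ) = E
decode (0ℙ , 1ℙ , 0ℙ , 1ℙ) = F
decode (0ℙ , 1ℙ , 1ℙ , 0ℙ) = G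
decode (0ℙ , 1ℙ , 1ℙ , 1ℙ) = H
decode (1ℙ , 0ℙ , 0ℙ , 0ℙ) = I
decode (1ℙ , 0ℙ , 0ℙ , 1ℙ) = J
decode (1ℙ , 0ℙ , 1ℙ , 0ℙ) = K
decode (1ℙ , 0ℙ , 1ℙ , 1ℙ) = L
decode (1ℙ , 1ℙ , 0ℙ , 0ℙ) = M
decode (1ℙ , 1ℙ , 0ℙ , 1ℙ) = N
decode (1ℙ , 1ℙ , 1ℙ , 0ℙ) = O
decode (1ℙ , 1ℙ , 1ℙ , 1ℙ) = P

decode-encode : ∀ X → decode (encode X) ≡ X
decode-encode A = refl
decode-encode B = refl
decode-encode C = refl
decode-encode D = refl
decode-encode E = refl
decode-encode F = refl
decode-encode G = refl
decode-encode H = refl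
decode-encode I = refl
decode-encode J = refl
decode-encode K = refl
decode-encode L = refl
decode-encode M = refl
decode-encode N = refl
decode-encode O = refl
decode-encode P = refl

encode-decode : ∀ β → encode (decode β) ≡ β
encode-decode (0ℙ , 0ℙ , 0ℙ , 0ℙ) = refl
encode-decode (0ℙ , 0ℙ , 0ℙ , 1ℙ) = refl
encode-decode (0ℙ , 0ℙ , 1ℙ , 0ℙ) = refl
encode-decode (0ℙ , 0ℙ , 1ℙ , 1ℙ) = refl
encode-decode (0ℙ , 1ℙ , 0ℙ , 0ℙ) = refl
encode-decode (0ℙ , 1ℙ , 0ℙ , 1ℙ) = refl
encode-decode (0ℙ , 1ℙ , 1ℙ , 0ℙ) = refl
encode-decode (0ℙ , 1ℙ , 1ℙ , 1ℙ) = refl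
encode-decode (1ℙ , 0ℙ , 0ℙ , 0ℙ) = refl
encode-decode (1ℙ , 0ℙ , 0ℙ , 1ℙ) = refl
encode-decode (1ℙ , 0ℙ , 1ℙ , 0ℙ) = refl
encode-decode (1ℙ , 0ℙ , 1ℙ , 1ℙ) = refl
encode-decode (1ℙ , 1ℙ , 0ℙ , 0ℙ) = refl
encode-decode (1ℙ , 1ℙ , 0ℙ , 1ℙ) = refl
encode-decode (1ℙ , 1ℙ , 1ℙ , 0ℙ) = refl
encode-decode (1ℙ , 1ℙ , 1ℙ , 1ℙ) = refl

encode-injective : ∀ {X Y} → encode X ≡ encode Y → X ≡ Y
encode-injective {X} {Y} eq = trans (sym (decode-encode X)) (trans (cong decode eq) (decode-encode Y))

_≟ᴸ_ : DecidableEquality Letter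
X ≟ᴸ Y = map′ encode-injective (cong encode) (encode X ≟ᴮ encode Y)
  where _≟ᴮ_ = ≡-dec _≟ᴾ_ (≡-dec _≟ᴾ_ (≡-dec _≟ᴾ_ _≟ᴾ_))

childBits : Bits → Parity → Parity → Bits
childBits (a , b , c , d) 0ℙ 0ℙ = a , 0ℙ , 0ℙ , c
childBits (a , b , c , d) 0ℙ 1ℙ = b , 1ℙ , 0ℙ , c ⁻¹
childBits (a , b , c , d) 1ℙ 0ℙ = a , 1ℙ , 1ℙ , d
childBits (a , b , c , d) 1ℙ 1ℙ = b , 0ℙ , 1ℙ , d

child : Letter → Parity → Parity → Letter
child X ρ γ = decode (childBits (encode X) ρ γ)

childRow : Letter → Parity → List Letter
childRow X ρ = child X ρ 0ℙ ∷ child X ρ 1ℙ ∷ []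

top≡childRow : ∀ X → top X ≡ childRow X 0ℙ
top≡childRow A = refl
top≡childRow B = refl
top≡childRow C = refl
top≡childRow D = refl
top≡childRow E = refl
top≡childRow F = refl
top≡childRow G = refl
top≡childRow H = refl
top≡childRow I = refl
top≡childRow J = refl
top≡childRow K = refl
top≡childRow L = refl
top≡childRow M = refl
top≡childRow N = refl
top≡childRow O = refl
top≡childRow P = refl

bot≡childRow : ∀ X → bot X ≡ childRow X 1ℙ
bot≡childRow A = refl
bot≡childRow B = refl
bot≡childRow C = refl
bot≡childRow D = refl
bot≡childRow E = refl
bot≡childRow F = refl
bot≡childRow G = refl
bot≡childRow H = refl
bot≡childRow I = refl
bot≡childRow J = refl
bot≡childRow K = refl
bot≡childRow L = refl
bot≡childRow M = refl
bot≡childRow N = refl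
bot≡childRow O = refl
bot≡childRow P = refl

columnRuleBits : Bits → Bits → Bits
columnRuleBits (a , b , 0ℙ , d) (a′ , _) = a′ ⁻¹ , b ⁻¹ , 0ℙ , d ⁻¹
columnRuleBits (a , b , 1ℙ , d) (a′ , _) = a′ ⁻¹ , b ⁻¹ , 1ℙ , d

rowRuleBits : Bits → Bits → Bits
rowRuleBits (a , b , _ , _) (_ , _ , _ , d′) = a , b ⁻¹ , 0ℙ , d′ ⁻¹

columnRule rowRule : Letter → Letter → Letter
columnRule Y Z = decode (columnRuleBits (encode Y) (encode Z))
rowRule Y Z = decode (rowRuleBits (encode Y) (encode Z))

columnRuleBits-childBits : ∀ β β′ ρ γ ι →
  childBits (childBits β ρ γ) ι 1ℙ ≡
  columnRuleBits (childBits (childBits β ρ γ) ι 0ℙ) (childBits (childBits β′ ρ (γ ⁻¹)) ι 1ℙ)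
columnRuleBits-childBits β β′ 0ℙ 0ℙ 0ℙ = refl
columnRuleBits-childBits β β′ 0ℙ 0ℙ 1ℙ = refl
columnRuleBits-childBits β β′ 0ℙ 1ℙ 0ℙ = refl
columnRuleBits-childBits β β′ 0ℙ 1ℙ 1ℙ = refl
columnRuleBits-childBits β β′ 1ℙ 0ℙ 0ℙ = refl
columnRuleBits-childBits β β′ 1ℙ 0ℙ 1ℙ = refl
columnRuleBits-childBits β β′ 1ℙ 1ℙ 0ℙ = refl
columnRuleBits-childBits β β′ 1ℙ 1ℙ 1ℙ = refl

rowRuleBits-childBits : ∀ β β′ ρ γ τ →
  childBits (childBits β (ρ ⁻¹) γ) 0ℙ τ ≡
  rowRuleBits (childBits (childBits β (ρ ⁻¹) γ) 1ℙ τ) (childBits (childBits β′ ρ γ) 0ℙ τ)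
rowRuleBits-childBits β β′ 0ℙ 0ℙ 0ℙ = refl
rowRuleBits-childBits β β′ 0ℙ 0ℙ 1ℙ = refl
rowRuleBits-childBits β β′ 0ℙ 1ℙ 0ℙ = refl
rowRuleBits-childBits β β′ 0ℙ 1ℙ 1ℙ = refl
rowRuleBits-childBits β β′ 1ℙ 0ℙ 0ℙ = refl
rowRuleBits-childBits β β′ 1ℙ 0ℙ 1ℙ = refl
rowRuleBits-childBits β β′ 1ℙ 1ℙ 0ℙ = refl
rowRuleBits-childBits β β′ 1ℙ 1ℙ 1ℙ = refl

encode-child² : ∀ X ρ γ ι τ → encode (child (child X ρ γ) ι τ) ≡ childBits (childBits (encode X) ρ γ) ι τ
encode-child² X ρ γ ι τ = trans (encode-decode _) (cong (λ β → childBits β ι τ) (encode-decode _))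

child²-columnRule : ∀ X X′ ρ {γ γ′} ι → γ ⁻¹ ≡ γ′ →
  child (child X ρ γ) ι 1ℙ ≡ columnRule (child (child X ρ γ) ι 0ℙ) (child (child X′ ρ γ′) ι 1ℙ)
child²-columnRule X X′ ρ {γ} ι refl = begin
  child (child X ρ γ) ι 1ℙ
    ≡⟨ decode-encode _ ⟨
  decode (encode (child (child X ρ γ) ι 1ℙ))
    ≡⟨ cong decode (trans (encode-child² X ρ γ ι 1ℙ) (columnRuleBits-childBits (encode X) (encode X′) ρ γ ι)) ⟩
  decode (columnRuleBits (childBits (childBits (encode X) ρ γ) ι 0ℙ) (childBits (childBits (encode X′) ρ (γ ⁻¹)) ι 1ℙ))
    ≡⟨ cong₂ (λ β β′ → decode (columnRuleBits β β′))
         (encode-child² X ρ γ ι 0ℙ) (encode-child² X′ ρ (γ ⁻¹) ι 1ℙ) ⟨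
  columnRule (child (child X ρ γ) ι 0ℙ) (child (child X′ ρ (γ ⁻¹)) ι 1ℙ) ∎
  where open ≡-Reasoning

child²-rowRule : ∀ X X′ {ρ ρ′} γ τ → ρ′ ⁻¹ ≡ ρ →
  child (child X ρ γ) 0ℙ τ ≡ rowRule (child (child X ρ γ) 1ℙ τ) (child (child X′ ρ′ γ) 0ℙ τ)
child²-rowRule X X′ {ρ′ = ρ′} γ τ refl = begin
  child (child X (ρ′ ⁻¹) γ) 0ℙ τ
    ≡⟨ decode-encode _ ⟨
  decode (encode (child (child X (ρ′ ⁻¹) γ) 0ℙ τ))
    ≡⟨ cong decode (trans (encode-child² X (ρ′ ⁻¹) γ 0ℙ τ) (rowRuleBits-childBits (encode X) (encode X′) ρ′ γ τ)) ⟩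
  decode (rowRuleBits (childBits (childBits (encode X) (ρ′ ⁻¹) γ) 1ℙ τ) (childBits (childBits (encode X′) ρ′ γ) 0ℙ τ))
    ≡⟨ cong₂ (λ β β′ → decode (rowRuleBits β β′))
         (encode-child² X (ρ′ ⁻¹) γ 1ℙ τ) (encode-child² X′ ρ′ γ 0ℙ τ) ⟨
  rowRule (child (child X (ρ′ ⁻¹) γ) 1ℙ τ) (child (child X′ ρ′ γ) 0ℙ τ) ∎
  where open ≡-Reasoning

Grid : Set
Grid = ℕ → ℕ → Letter

table : ℕ → ℕ → Grid → Matrix
table m n f = applyUpTo (λ a → applyUpTo (f a) n) m

window : Grid → (r c m n : ℕ) → Matrix
window f r c m n = table m n (λ a b → f (r + a) (c + b))

table-cong : ∀ m n {f g : Grid} → (∀ {a b} → a < m → b < n → f a b ≡ g a b) → table m n f ≡ table m n g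
table-cong m n f≗g = applyUpTo-cong m (λ a<m → applyUpTo-cong n (f≗g a<m))

table-injective : ∀ {m n} (f g : Grid) → table m n f ≡ table m n g → ∀ {a b} → a < m → b < n → f a b ≡ g a b
table-injective f g eq a<m = applyUpTo-injective (applyUpTo-injective eq a<m)

take-drop-applyUpTo : ∀ (f : ℕ → Elem) {r m n} → r + m ≤ n →
  take m (drop r (applyUpTo f n)) ≡ applyUpTo (λ i → f (r + i)) m
take-drop-applyUpTo f {r} {m} {n} r+m≤n = begin
  take m (drop r (applyUpTo f n))              ≡⟨ cong (take m) (drop-applyUpTo f r n) ⟩
  take m (applyUpTo (λ i → f (r + i)) (n ∸ r)) ≡⟨ take-applyUpTo _ (r+m≤n⇒m≤n∸r r+m≤n) ⟩
  applyUpTo (λ i → f (r + i)) m                ∎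
  where open ≡-Reasoning

sub-table : ∀ {r c m n h w} (f : Grid) → r + m ≤ h → c + n ≤ w → sub r c m n (table h w f) ≡ window f r c m n
sub-table {r} {c} {m} {n} {h} {w} f r+m≤h c+n≤w = begin
  map (λ row → take n (drop c row)) (take m (drop r (table h w f)))
    ≡⟨ cong (map _) (take-drop-applyUpTo _ r+m≤h) ⟩
  map (λ row → take n (drop c row)) (applyUpTo (λ a → applyUpTo (f (r + a)) w) m)
    ≡⟨ map-applyUpTo _ _ m ⟩
  applyUpTo (λ a → take n (drop c (applyUpTo (f (r + a)) w))) m
    ≡⟨ applyUpTo-cong m (λ _ → take-drop-applyUpTo _ c+n≤w) ⟩
  window f r c m n ∎
  where open ≡-Reasoning

map-take-table : ∀ m {n n′} (f : Grid) → n ≤ n′ → map (take n) (table m n′ f) ≡ table m n f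
map-take-table m f n≤n′ = trans (map-applyUpTo _ _ m) (applyUpTo-cong m (λ _ → take-applyUpTo _ n≤n′))

table-cong-lastColumn : ∀ (R : Letter → Letter → Letter) {f g : Grid} m n →
  (∀ a → f a (2 + n) ≡ R (f a (1 + n)) (f a n)) → (∀ a → g a (2 + n) ≡ R (g a (1 + n)) (g a n)) →
  table m (2 + n) f ≡ table m (2 + n) g → table m (3 + n) f ≡ table m (3 + n) g
table-cong-lastColumn R {f} {g} m n rule-f rule-g eq = table-cong m (3 + n) agree
  where
  front-agrees : ∀ {a b} → a < m → b < 2 + n → f a b ≡ g a b
  front-agrees = table-injective f g eq
  agree : ∀ {a b} → a < m → b < 3 + n → f a b ≡ g a b
  agree {a} {b} a<m b<3+n with m<1+n⇒m<n∨m≡n b<3+n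
  ... | inj₁ b<2+n = front-agrees a<m b<2+n
  ... | inj₂ refl  = begin
    f a (2 + n)              ≡⟨ rule-f a ⟩
    R (f a (1 + n)) (f a n)  ≡⟨ cong₂ R (front-agrees a<m (n<1+n (1 + n))) (front-agrees a<m (m<n⇒m<1+n (n<1+n n))) ⟩
    R (g a (1 + n)) (g a n)  ≡⟨ rule-g a ⟨
    g a (2 + n)              ∎
    where open ≡-Reasoning

table-cong-firstRow : ∀ (R : Letter → Letter → Letter) {f g : Grid} m n →
  (∀ b → f 0 b ≡ R (f 1 b) (f 2 b)) → (∀ b → g 0 b ≡ R (g 1 b) (g 2 b)) →
  drop 1 (table (3 + m) n f) ≡ drop 1 (table (3 + m) n g) → table (3 + m) n f ≡ table (3 + m) n g
table-cong-firstRow R {f} {g} m n rule-f rule-g eq = table-cong (3 + m) n agree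
  where
  lower-rows-agree : ∀ {a b} → a < 2 + m → b < n → f (suc a) b ≡ g (suc a) b
  lower-rows-agree = table-injective (λ a → f (suc a)) (λ a → g (suc a)) eq
  agree : ∀ {a b} → a < 3 + m → b < n → f a b ≡ g a b
  agree {zero}  {b} _ b<n = begin
    f 0 b               ≡⟨ rule-f b ⟩
    R (f 1 b) (f 2 b)   ≡⟨ cong₂ R (lower-rows-agree (s≤s z≤n) b<n) (lower-rows-agree (s≤s (s≤s z≤n)) b<n) ⟩
    R (g 1 b) (g 2 b)   ≡⟨ rule-g b ⟨
    g 0 b               ∎
    where open ≡-Reasoning
  agree {suc a} (s≤s a<2+m) b<n = lower-rows-agree a<2+m b<n

-- Supertiles

μ-grid : Grid → Grid
μ-grid f x y = child (f ⌊ x /2⌋ ⌊ y /2⌋) (parity x) (parity y)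

concatMap-childRow : ∀ {g : Letter → List Letter} ρ → (∀ Y → g Y ≡ childRow Y ρ) →
  ∀ (f : ℕ → Letter) n → concatMap g (applyUpTo f n) ≡ applyUpTo (λ y → child (f ⌊ y /2⌋) ρ (parity y)) (n * 2)
concatMap-childRow ρ g≡ f zero    = refl
concatMap-childRow ρ g≡ f (suc n) rewrite g≡ (f 0) =
  cong (λ ys → _ ∷ _ ∷ ys) (concatMap-childRow ρ g≡ (λ j → f (suc j)) n)

μ-table : ∀ m n f → μ (table m n f) ≡ table (m * 2) (n * 2) (μ-grid f)
μ-table zero    n f = refl
μ-table (suc m) n f =
  cong₂ _∷_ (concatMap-childRow 0ℙ top≡childRow (f 0) n)
   (cong₂ _∷_ (concatMap-childRow 1ℙ bot≡childRow (f 0) n)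
     (μ-table m n (λ a → f (suc a))))

supertile : ℕ → Letter → Grid
supertile zero    Y = λ _ _ → Y
supertile (suc k) Y = μ-grid (supertile k Y)

μ^-suc : ∀ k x → μ^ (suc k) x ≡ μ (μ^ k x)
μ^-suc zero    x = refl
μ^-suc (suc k) x = μ^-suc k (μ x)

T≡table : ∀ k → T k ≡ table (2 ^ k) (2 ^ k) (supertile k N)
T≡table zero    = refl
T≡table (suc k) = begin
  T (suc k)                                                 ≡⟨ μ^-suc k _ ⟩
  μ (T k)                                                   ≡⟨ cong μ (T≡table k) ⟩
  μ (table (2 ^ k) (2 ^ k) (supertile k N))                 ≡⟨ μ-table (2 ^ k) (2 ^ k) _ ⟩
  table (2 ^ k * 2) (2 ^ k * 2) (supertile (suc k) N)       ≡⟨ cong (λ s → table s s (supertile (suc k) N)) (*-comm (2 ^ k) 2) ⟩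
  table (2 ^ suc k) (2 ^ suc k) (supertile (suc k) N)       ∎
  where open ≡-Reasoning

μ-grid-offset : ∀ (f : Grid) p q x y → μ-grid f (p * 2 + x) (q * 2 + y) ≡ μ-grid (λ a b → f (p + a) (q + b)) x y
μ-grid-offset f p q x y
  rewrite ⌊m*2+n/2⌋≡m+⌊n/2⌋ p x | ⌊m*2+n/2⌋≡m+⌊n/2⌋ q y
        | parity[m*2+n]≡parity[n] p x | parity[m*2+n]≡parity[n] q y = refl

supertile-+ : ∀ j k Y p q u v →
  supertile (j + k) Y (p * 2 ^ j + u) (q * 2 ^ j + v) ≡ supertile j (supertile k Y (p + ⌊ u /2^ j ⌋) (q + ⌊ v /2^ j ⌋)) u v
supertile-+ zero    k Y p q u v = cong₂ (λ x y → supertile k Y (x + u) (y + v)) (*-identityʳ p) (*-identityʳ q)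
supertile-+ (suc j) k Y p q u v = begin
  μ-grid (supertile (j + k) Y) (p * 2 ^ suc j + u) (q * 2 ^ suc j + v)
    ≡⟨ cong₂ (λ x y → μ-grid (supertile (j + k) Y) (x + u) (y + v)) (m*2^[1+n]≡m*2^n*2 p j) (m*2^[1+n]≡m*2^n*2 q j) ⟩
  μ-grid (supertile (j + k) Y) (p * 2 ^ j * 2 + u) (q * 2 ^ j * 2 + v)
    ≡⟨ μ-grid-offset (supertile (j + k) Y) (p * 2 ^ j) (q * 2 ^ j) u v ⟩
  child (supertile (j + k) Y (p * 2 ^ j + ⌊ u /2⌋) (q * 2 ^ j + ⌊ v /2⌋)) (parity u) (parity v)
    ≡⟨ cong (λ Z → child Z (parity u) (parity v)) (supertile-+ j k Y p q ⌊ u /2⌋ ⌊ v /2⌋) ⟩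
  supertile (suc j) (supertile k Y (p + ⌊ u /2^ suc j ⌋) (q + ⌊ v /2^ suc j ⌋)) u v ∎
  where open ≡-Reasoning

-- T₃ has N at (4, 3).
supertile-embed : ∀ k {x y} → x < 2 ^ k → y < 2 ^ k → supertile (k + 3) N (4 * 2 ^ k + x) (3 * 2 ^ k + y) ≡ supertile k N x y
supertile-embed k {x} {y} x<2^k y<2^k = begin
  supertile (k + 3) N (4 * 2 ^ k + x) (3 * 2 ^ k + y)
    ≡⟨ supertile-+ k 3 N 4 3 x y ⟩
  supertile k (supertile 3 N (4 + ⌊ x /2^ k ⌋) (3 + ⌊ y /2^ k ⌋)) x y
    ≡⟨ cong₂ (λ a b → supertile k (supertile 3 N (4 + a) (3 + b)) x y) (⌊u/2^j⌋≡0 k x<2^k) (⌊u/2^j⌋≡0 k y<2^k) ⟩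
  supertile k N x y ∎
  where open ≡-Reasoning

μ-grid-window : ∀ (f : Grid) r c i j m n →
  window (μ-grid f) (r * 2 + i) (c * 2 + j) m n ≡ window (μ-grid (λ a b → f (r + a) (c + b))) i j m n
μ-grid-window f r c i j m n = table-cong m n λ {a} {b} _ _ →
  trans (cong₂ (μ-grid f) (+-assoc (r * 2) i a) (+-assoc (c * 2) j b)) (μ-grid-offset f r c (i + a) (j + b))

window-μ-grid-cong : ∀ {f g : Grid} {r c r′ c′ i j m n} → i ≤ 1 → j ≤ 1 →
  window f r c m n ≡ window g r′ c′ m n →
  window (μ-grid f) (r * 2 + i) (c * 2 + j) m n ≡ window (μ-grid g) (r′ * 2 + i) (c′ * 2 + j) m n
window-μ-grid-cong {f} {g} {r} {c} {r′} {c′} {i} {j} {m} {n} i≤1 j≤1 eq = begin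
  window (μ-grid f) (r * 2 + i) (c * 2 + j) m n                      ≡⟨ μ-grid-window f r c i j m n ⟩
  window (μ-grid (λ a b → f (r + a) (c + b))) i j m n                ≡⟨ table-cong m n (λ a<m b<n →
    cong (λ Z → child Z _ _) (agree (⌊i+a/2⌋<m i≤1 a<m) (⌊i+a/2⌋<m j≤1 b<n))) ⟩
  window (μ-grid (λ a b → g (r′ + a) (c′ + b))) i j m n              ≡⟨ μ-grid-window g r′ c′ i j m n ⟨
  window (μ-grid g) (r′ * 2 + i) (c′ * 2 + j) m n                    ∎
  where open ≡-Reasoning
        agree : ∀ {a b} → a < m → b < n → f (r + a) (c + b) ≡ g (r′ + a) (c′ + b)
        agree = table-injective (λ a b → f (r + a) (c + b)) (λ a b → g (r′ + a) (c′ + b)) eq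

supertile-columnRule : ∀ k Y x {y} → parity y ≡ 1ℙ →
  supertile (2 + k) Y x (2 + y) ≡ columnRule (supertile (2 + k) Y x (1 + y)) (supertile (2 + k) Y x y)
supertile-columnRule k Y x {y} odd = begin
  child (S x′ (suc h)) (parity x) (parity y)
    ≡⟨ cong (child (S x′ (suc h)) (parity x)) odd ⟩
  child (S x′ (suc h)) (parity x) 1ℙ
    ≡⟨ child²-columnRule (supertile k Y ⌊ x′ /2⌋ ⌊ suc h /2⌋) (supertile k Y ⌊ x′ /2⌋ ⌊ h /2⌋)
         (parity x′) (parity x) (suc-homo-⁻¹ h) ⟩
  columnRule (child (S x′ (suc h)) (parity x) 0ℙ) (child (S x′ h) (parity x) 1ℙ)
    ≡⟨ cong₂ columnRule
         (cong₂ (λ b p → child (S x′ b) (parity x) p)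
           (⌊1+n/2⌋≡1+⌊n/2⌋ odd) (trans (parity[1+n]≡parity[n]⁻¹ y) (cong _⁻¹ odd)))
         (cong (child (S x′ h) (parity x)) odd) ⟨
  columnRule (child (S x′ ⌊ suc y /2⌋) (parity x) (parity (suc y))) (child (S x′ h) (parity x) (parity y)) ∎
  where open ≡-Reasoning
        S  = supertile (suc k) Y
        x′ = ⌊ x /2⌋
        h  = ⌊ y /2⌋

supertile-rowRule : ∀ k Y {x} y → parity x ≡ 0ℙ →
  supertile (2 + k) Y x y ≡ rowRule (supertile (2 + k) Y (1 + x) y) (supertile (2 + k) Y (2 + x) y)
supertile-rowRule k Y {x} y even = begin
  child (S h y′) (parity x) (parity y)
    ≡⟨ cong (λ p → child (S h y′) p (parity y)) even ⟩
  child (S h y′) 0ℙ (parity y)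
    ≡⟨ child²-rowRule (supertile k Y ⌊ h /2⌋ ⌊ y′ /2⌋) (supertile k Y ⌊ suc h /2⌋ ⌊ y′ /2⌋)
         (parity y′) (parity y) (suc-homo-⁻¹ h) ⟩
  rowRule (child (S h y′) 1ℙ (parity y)) (child (S (suc h) y′) 0ℙ (parity y))
    ≡⟨ cong₂ rowRule
         (cong₂ (λ a p → child (S a y′) p (parity y))
           (⌊1+n/2⌋≡⌊n/2⌋ even) (trans (parity[1+n]≡parity[n]⁻¹ x) (cong _⁻¹ even)))
         (cong (λ p → child (S (suc h) y′) p (parity y)) even) ⟨
  rowRule (child (S ⌊ suc x /2⌋ y′) (parity (suc x)) (parity y)) (child (S (suc h) y′) (parity x) (parity y)) ∎
  where open ≡-Reasoning
        S  = supertile (suc k) Y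
        h  = ⌊ x /2⌋
        y′ = ⌊ y /2⌋

supertile-columnRule-at : ∀ k Y x y n → parity (y + n) ≡ 1ℙ →
  supertile (2 + k) Y x (y + (2 + n)) ≡ columnRule (supertile (2 + k) Y x (y + (1 + n))) (supertile (2 + k) Y x (y + n))
supertile-columnRule-at k Y x y n odd rewrite +-suc y (suc n) | +-suc y n = supertile-columnRule k Y x odd

supertile-rowRule-at : ∀ k Y x y → parity x ≡ 0ℙ →
  supertile (2 + k) Y (x + 0) y ≡ rowRule (supertile (2 + k) Y (x + 1) y) (supertile (2 + k) Y (x + 2) y)
supertile-rowRule-at k Y x y even rewrite +-identityʳ x | +-suc x 1 | +-suc x 0 | +-identityʳ x = supertile-rowRule k Y y even

Fits : (m n k r c : ℕ) → Set
Fits m n k r c = (r + m ≤ 2 ^ k) × (c + n ≤ 2 ^ k)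

-- P_{i+1,j+1}(T, m×n), with 0-based offsets i, j ∈ {0, 1}.
Window : (i j m n : ℕ) → Matrix → Set
Window i j m n z = Σ ℕ λ k → Σ ℕ λ r → Σ ℕ λ c →
  Fits m n k r c × (z ≡ window (supertile (suc k) N) (r * 2 + i) (c * 2 + j) m n)

sub-μ-sub-T : ∀ {i j m n k r c} → i ≤ 1 → j ≤ 1 → 1 ≤ m → 1 ≤ n → Fits m n k r c →
  sub i j m n (μ (sub r c m n (T k))) ≡ window (supertile (suc k) N) (r * 2 + i) (c * 2 + j) m n
sub-μ-sub-T {i} {j} {m} {n} {k} {r} {c} i≤1 j≤1 1≤m 1≤n (r+m≤2^k , c+n≤2^k) = begin
  sub i j m n (μ (sub r c m n (T k)))
    ≡⟨ cong (λ x → sub i j m n (μ (sub r c m n x))) (T≡table k) ⟩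
  sub i j m n (μ (sub r c m n (table (2 ^ k) (2 ^ k) (supertile k N))))
    ≡⟨ cong (λ x → sub i j m n (μ x)) (sub-table (supertile k N) r+m≤2^k c+n≤2^k) ⟩
  sub i j m n (μ (window (supertile k N) r c m n))
    ≡⟨ cong (sub i j m n) (μ-table m n _) ⟩
  sub i j m n (table (m * 2) (n * 2) (μ-grid (λ a b → supertile k N (r + a) (c + b))))
    ≡⟨ sub-table _ (i+m≤m*2 i≤1 1≤m) (i+m≤m*2 j≤1 1≤n) ⟩
  window (μ-grid (λ a b → supertile k N (r + a) (c + b))) i j m n
    ≡⟨ μ-grid-window (supertile k N) r c i j m n ⟨
  window (supertile (suc k) N) (r * 2 + i) (c * 2 + j) m n ∎
  where open ≡-Reasoning

Window⇔InPij : ∀ {i j m n z} → i ≤ 1 → j ≤ 1 → 1 ≤ m → 1 ≤ n → Window i j m n z ⇔ InPij (suc i) (suc j) m n z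
Window⇔InPij {i} {j} {m} {n} i≤1 j≤1 1≤m 1≤n = mk⇔
  (λ { (k , r , c , fits@(r+m≤ , c+n≤) , refl) →
         sub r c m n (T k) , (k , r , c , r+m≤ , c+n≤ , refl) , sym (sub-μ-sub-T {k = k} {r} {c} i≤1 j≤1 1≤m 1≤n fits) })
  (λ { (_ , (k , r , c , r+m≤ , c+n≤ , refl) , refl) →
         k , r , c , (r+m≤ , c+n≤) , sub-μ-sub-T {k = k} {r} {c} i≤1 j≤1 1≤m 1≤n (r+m≤ , c+n≤) })

6*x+[x+x]≡x*8 : ∀ x → 6 * x + (x + x) ≡ x * 8
6*x+[x+x]≡x*8 = solve-∀

offset-fits : ∀ {p} k {r m} → p ≤ 6 → r + m ≤ 2 ^ k → p * 2 ^ k + r + suc m ≤ 2 ^ (k + 3)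
offset-fits {p} k {r} {m} p≤6 r+m≤2^k = begin
  p * 2 ^ k + r + suc m        ≡⟨ +-assoc (p * 2 ^ k) r (suc m) ⟩
  p * 2 ^ k + (r + suc m)      ≡⟨ cong (p * 2 ^ k +_) (+-suc r m) ⟩
  p * 2 ^ k + suc (r + m)      ≤⟨ +-mono-≤ (*-monoˡ-≤ (2 ^ k) p≤6) (+-mono-≤ (m^n>0 2 k) r+m≤2^k) ⟩
  6 * 2 ^ k + (2 ^ k + 2 ^ k)  ≡⟨ 6*x+[x+x]≡x*8 (2 ^ k) ⟩
  2 ^ k * 2 ^ 3                ≡⟨ ^-distribˡ-+-* 2 k 3 ⟨
  2 ^ (k + 3)                  ∎
  where open ≤-Reasoning

relocate : ∀ {m n k r c} → Fits m n k r c →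
  Σ ℕ λ k′ → Σ ℕ λ r′ → Σ ℕ λ c′ →
    Fits (suc m) (suc n) k′ r′ c′ × window (supertile k′ N) r′ c′ m n ≡ window (supertile k N) r c m n
relocate {m} {n} {k} {r} {c} (r+m≤2^k , c+n≤2^k) =
  k + 3 , 4 * 2 ^ k + r , 3 * 2 ^ k + c ,
  (offset-fits k (m≤m+n 4 2) r+m≤2^k , offset-fits k (m≤m+n 3 3) c+n≤2^k) ,
  table-cong m n λ {a} {b} a<m b<n →
    trans (cong₂ (supertile (k + 3) N) (+-assoc (4 * 2 ^ k) r a) (+-assoc (3 * 2 ^ k) c b))
          (supertile-embed k (<-≤-trans (+-monoʳ-< r a<m) r+m≤2^k) (<-≤-trans (+-monoʳ-< c b<n) c+n≤2^k))

Window-relocate : ∀ {i j m n z} → i ≤ 1 → j ≤ 1 → Window i j m n z →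
  Σ ℕ λ k → Σ ℕ λ r → Σ ℕ λ c →
    Fits (suc m) (suc n) k r c × z ≡ window (supertile (suc k) N) (r * 2 + i) (c * 2 + j) m n
Window-relocate i≤1 j≤1 (k , r , c , fits , refl) with relocate {k = k} {r} {c} fits
... | k′ , r′ , c′ , fits′ , same =
  k′ , r′ , c′ , fits′ , sym (window-μ-grid-cong {supertile k′ N} {supertile k N} {r′} {c′} {r} {c} i≤1 j≤1 same)

-- Deleting a column or a row

HasCard-map : ∀ {S S′ : Matrix → Set} {κ} (φ : Matrix → Matrix) →
  (∀ {z} → S z → S′ (φ z)) →
  (∀ {y} → S′ y → Σ Matrix λ z → S z × φ z ≡ y) →
  (∀ {z z′} → S z → S z′ → φ z ≡ φ z′ → z ≡ z′) →
  HasCard S κ → HasCard S′ κ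
HasCard-map {S′ = S′} φ into onto inj (zs , unique , length≡ , ∈⇔S) =
  map φ zs ,
  Unique-map-on φ inj (All.tabulate (Equivalence.to (∈⇔S _))) unique ,
  trans (length-map φ zs) length≡ ,
  λ y → mk⇔
    (λ y∈ → let z , z∈ , y≡φz = ∈-map⁻ φ y∈ in subst S′ (sym y≡φz) (into (Equivalence.to (∈⇔S z) z∈)))
    (λ S′y → let z , Sz , φz≡y = onto S′y in subst (_∈ map φ zs) φz≡y (∈-map⁺ φ (Equivalence.from (∈⇔S z) Sz)))

HasCard-resp : ∀ {S S′ : Matrix → Set} {κ} → (∀ {y} → S y ⇔ S′ y) → HasCard S κ → HasCard S′ κ
HasCard-resp S⇔S′ (xs , unique , length≡ , ∈⇔S) = xs , unique , length≡ , λ y →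
  mk⇔ (Equivalence.to S⇔S′ ∘ Equivalence.to (∈⇔S y)) (Equivalence.from (∈⇔S y) ∘ Equivalence.from S⇔S′)

positive-level : ∀ {k c n} → c + suc (suc n) ≤ 2 ^ k → Σ ℕ λ k′ → k ≡ suc k′
positive-level {zero} {c} {n} c+2+n≤1 with ≤-trans (m≤n+m (suc (suc n)) c) c+2+n≤1
... | s≤s ()
positive-level {suc k} _ = k , refl

Window-dropColumn : ∀ {i j m w κ} → i ≤ 1 → j ≤ 1 → 2 ≤ w → parity (j + w) ≡ 1ℙ →
  HasCard (Window i j m (suc w)) κ → HasCard (Window i j m w) κ
Window-dropColumn {i} {j} {m} {w@(suc (suc n))} i≤1 j≤1 (s≤s (s≤s _)) odd = HasCard-map (map (take w)) into onto inj
  where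
  grid : ℕ → ℕ → ℕ → Grid
  grid k r c a b = supertile (suc k) N (r * 2 + i + a) (c * 2 + j + b)
  into : ∀ {z} → Window i j m (suc w) z → Window i j m w (map (take w) z)
  into (k , r , c , (r+m≤ , c+w+1≤) , refl) =
    k , r , c , (r+m≤ , ≤-trans (+-monoʳ-≤ c (n≤1+n w)) c+w+1≤) , map-take-table m (grid k r c) (n≤1+n w)
  onto : ∀ {y} → Window i j m w y → Σ Matrix λ z → Window i j m (suc w) z × map (take w) z ≡ y
  onto Wy with Window-relocate i≤1 j≤1 Wy
  ... | k , r , c , (r+m+1≤ , c+w+1≤) , refl =
    _ , (k , r , c , (≤-trans (+-monoʳ-≤ r (n≤1+n m)) r+m+1≤ , c+w+1≤) , refl) , map-take-table m (grid k r c) (n≤1+n w)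
  odd-column : ∀ c → parity (c * 2 + j + n) ≡ 1ℙ
  odd-column c = begin
    parity (c * 2 + j + n)             ≡⟨ cong parity (+-assoc (c * 2) j n) ⟩
    parity (c * 2 + (j + n))           ≡⟨ parity[m*2+n]≡parity[n] c (j + n) ⟩
    parity (j + n)                     ≡⟨ cong parity (trans (+-suc j (suc n)) (cong suc (+-suc j n))) ⟨
    parity (j + w)                     ≡⟨ odd ⟩
    1ℙ                                 ∎
    where open ≡-Reasoning
  inj : ∀ {z z′} → Window i j m (suc w) z → Window i j m (suc w) z′ → map (take w) z ≡ map (take w) z′ → z ≡ z′
  inj (k , r , c , (_ , c+w+1≤) , refl) (k′ , r′ , c′ , (_ , c′+w+1≤) , refl) same
    with positive-level {k} {c} c+w+1≤ | positive-level {k′} {c′} c′+w+1≤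
  ... | l , refl | l′ , refl =
    table-cong-lastColumn columnRule {grid k r c} {grid k′ r′ c′} m n
      (λ a → supertile-columnRule-at l N (r * 2 + i + a) (c * 2 + j) n (odd-column c))
      (λ a → supertile-columnRule-at l′ N (r′ * 2 + i + a) (c′ * 2 + j) n (odd-column c′))
      (trans (sym (map-take-table m (grid k r c) (n≤1+n w))) (trans same (map-take-table m (grid k′ r′ c′) (n≤1+n w))))

x+0+[1+a]≡x+1+a : ∀ x a → x + 0 + suc a ≡ x + 1 + a
x+0+[1+a]≡x+1+a = solve-∀

Window-dropRow : ∀ {j m n κ} → j ≤ 1 → 2 ≤ m → HasCard (Window 0 j (suc m) n) κ → HasCard (Window 1 j m n) κ
Window-dropRow {j} {m@(suc (suc m′))} {n} j≤1 (s≤s (s≤s _)) = HasCard-map (drop 1) into onto inj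
  where
  grid : ℕ → ℕ → ℕ → Grid
  grid k r c a b = supertile (suc k) N (r * 2 + 0 + a) (c * 2 + j + b)
  drop-window : ∀ k r c →
    drop 1 (window (supertile (suc k) N) (r * 2 + 0) (c * 2 + j) (suc m) n) ≡
    window (supertile (suc k) N) (r * 2 + 1) (c * 2 + j) m n
  drop-window k r c =
    table-cong m n {λ a → grid k r c (suc a)} {λ a b → supertile (suc k) N (r * 2 + 1 + a) (c * 2 + j + b)}
      λ {a} {b} _ _ → cong (λ x → supertile (suc k) N x (c * 2 + j + b)) (x+0+[1+a]≡x+1+a (r * 2) a)
  into : ∀ {z} → Window 0 j (suc m) n z → Window 1 j m n (drop 1 z)
  into (k , r , c , (r+m+1≤ , c+n≤) , refl) =
    k , r , c , (≤-trans (+-monoʳ-≤ r (n≤1+n m)) r+m+1≤ , c+n≤) , drop-window k r c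
  onto : ∀ {y} → Window 1 j m n y → Σ Matrix λ z → Window 0 j (suc m) n z × drop 1 z ≡ y
  onto Wy with Window-relocate (s≤s z≤n) j≤1 Wy
  ... | k , r , c , (r+m+1≤ , c+n+1≤) , refl =
    _ , (k , r , c , (r+m+1≤ , ≤-trans (+-monoʳ-≤ c (n≤1+n n)) c+n+1≤) , refl) , drop-window k r c
  inj : ∀ {z z′} → Window 0 j (suc m) n z → Window 0 j (suc m) n z′ → drop 1 z ≡ drop 1 z′ → z ≡ z′
  inj (k , r , c , (r+m+1≤ , _) , refl) (k′ , r′ , c′ , (r′+m+1≤ , _) , refl) same
    with positive-level {k} {r} r+m+1≤ | positive-level {k′} {r′} r′+m+1≤
  ... | l , refl | l′ , refl =
    table-cong-firstRow rowRule {grid k r c} {grid k′ r′ c′} m′ n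
      (λ b → supertile-rowRule-at l N (r * 2 + 0) (c * 2 + j + b) (parity[m*2+n]≡parity[n] r 0))
      (λ b → supertile-rowRule-at l′ N (r′ * 2 + 0) (c′ * 2 + j + b) (parity[m*2+n]≡parity[n] r′ 0))
      same

-- Finiteness

_≟ᴹ_ : DecidableEquality Matrix
_≟ᴹ_ = List.≡-dec (List.≡-dec _≟ᴸ_)

HasCard-deduplicate : ∀ {S : Matrix → Set} (xs : List Matrix) → (∀ y → y ∈ xs ⇔ S y) →
  HasCard S (length (deduplicate _≟ᴹ_ xs))
HasCard-deduplicate xs ∈⇔S = deduplicate _≟ᴹ_ xs , deduplicate-! _≟ᴹ_ xs , refl ,
  λ y → mk⇔ (λ y∈ → Equivalence.to (∈⇔S y) (∈-deduplicate⁻ _≟ᴹ_ xs y∈))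
            (λ Sy → ∈-deduplicate⁺ _≟ᴹ_ (Equivalence.from (∈⇔S y) Sy))

Quad : Set
Quad = Letter × Letter × Letter × Letter

_≟Q_ : DecidableEquality Quad
_≟Q_ = ≡-dec _≟ᴸ_ (≡-dec _≟ᴸ_ (≡-dec _≟ᴸ_ _≟ᴸ_))

square : Grid → Quad
square f = f 0 0 , f 0 1 , f 1 0 , f 1 1

entry : Quad → Grid
entry (a , b , c , d) zero    zero    = a
entry (a , b , c , d) zero    (suc _) = b
entry (a , b , c , d) (suc _) zero    = c
entry (a , b , c , d) (suc _) (suc _) = d

entry-square : ∀ (f : Grid) {x y} → x ≤ 1 → y ≤ 1 → entry (square f) x y ≡ f x y
entry-square f z≤n       z≤n       = refl
entry-square f z≤n       (s≤s z≤n) = refl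
entry-square f (s≤s z≤n) z≤n       = refl
entry-square f (s≤s z≤n) (s≤s z≤n) = refl

square-cong : ∀ {f g : Grid} → (∀ {x y} → x ≤ 1 → y ≤ 1 → f x y ≡ g x y) → square f ≡ square g
square-cong f≗g = cong₂ _,_ (f≗g z≤n z≤n) (cong₂ _,_ (f≗g z≤n o) (cong₂ _,_ (f≗g o z≤n) (f≗g o o)))
  where o = s≤s z≤n

quadAt : ℕ → ℕ → ℕ → Quad
quadAt k p q = square (λ a b → supertile k N (p + a) (q + b))

subquad : Quad → ℕ → ℕ → Quad
subquad sq s t = square (λ a b → μ-grid (entry sq) (s + a) (t + b))

-- One occurrence in T₅ of each of the 76 distinct 2×2 blocks of T.
sites : List (ℕ × ℕ)
sites =
  (0 , 0) ∷ (0 , 1) ∷ (0 , 2) ∷ (0 , 3) ∷ (0 , 4) ∷ (0 , 5) ∷ (0 , 6) ∷ (0 , 11) ∷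
  (1 , 0) ∷ (1 , 1) ∷ (1 , 2) ∷ (1 , 3) ∷ (1 , 4) ∷ (1 , 5) ∷ (1 , 6) ∷ (1 , 11) ∷
  (2 , 0) ∷ (2 , 1) ∷ (2 , 2) ∷ (2 , 3) ∷ (2 , 4) ∷ (2 , 5) ∷ (2 , 6) ∷ (2 , 7) ∷ (2 , 8) ∷ (2 , 11) ∷ (2 , 12) ∷ (2 , 15) ∷
  (3 , 0) ∷ (3 , 1) ∷ (3 , 2) ∷ (3 , 3) ∷ (3 , 4) ∷ (3 , 5) ∷ (3 , 6) ∷ (3 , 7) ∷ (3 , 8) ∷ (3 , 11) ∷ (3 , 12) ∷ (3 , 15) ∷
  (4 , 0) ∷ (4 , 1) ∷ (4 , 2) ∷ (4 , 3) ∷ (4 , 4) ∷ (4 , 5) ∷ (4 , 6) ∷ (4 , 11) ∷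
  (5 , 0) ∷ (5 , 1) ∷ (5 , 2) ∷ (5 , 3) ∷ (5 , 4) ∷ (5 , 5) ∷ (5 , 6) ∷ (5 , 11) ∷
  (6 , 1) ∷ (6 , 2) ∷ (6 , 3) ∷ (6 , 11) ∷ (6 , 13) ∷ (6 , 14) ∷
  (7 , 1) ∷ (7 , 2) ∷ (7 , 3) ∷ (7 , 4) ∷ (7 , 11) ∷ (7 , 12) ∷ (7 , 13) ∷ (7 , 14) ∷
  (14 , 3) ∷ (14 , 27) ∷ (15 , 3) ∷ (15 , 4) ∷ (15 , 27) ∷ (15 , 28) ∷ []

Legal : Quad → Set
Legal sq = Any (λ (p , q) → sq ≡ quadAt 5 p q) sites

legal? : ∀ sq → Dec (Legal sq)
legal? sq = any? (λ (p , q) → sq ≟Q quadAt 5 p q) sites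

offsets : List (ℕ × ℕ)
offsets = cartesianProduct (upTo 3) (upTo 3)

legal-closure : All (λ (p , q) → All (λ (s , t) → Legal (subquad (quadAt 5 p q) s t)) offsets) sites
legal-closure = from-yes (all? (λ (p , q) → all? (λ (s , t) → legal? (subquad (quadAt 5 p q) s t)) offsets) sites)

legal-base : Legal (quadAt 1 0 0)
legal-base = from-yes (legal? (quadAt 1 0 0))

sites-fit : All (λ (p , q) → p + 2 ≤ 32 × q + 2 ≤ 32) sites
sites-fit = from-yes (all? (λ (p , q) → (p + 2 ≤? 32) ×-dec (q + 2 ≤? 32)) sites)

quadAt-μ : ∀ k p q {s t} → s ≤ 2 → t ≤ 2 → quadAt (suc k) (p * 2 + s) (q * 2 + t) ≡ subquad (quadAt k p q) s t
quadAt-μ k p q {s} {t} s≤2 t≤2 = square-cong λ {x} {y} x≤1 y≤1 → begin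
  μ-grid (supertile k N) (p * 2 + s + x) (q * 2 + t + y)
    ≡⟨ cong₂ (μ-grid (supertile k N)) (+-assoc (p * 2) s x) (+-assoc (q * 2) t y) ⟩
  μ-grid (supertile k N) (p * 2 + (s + x)) (q * 2 + (t + y))
    ≡⟨ μ-grid-offset (supertile k N) p q (s + x) (t + y) ⟩
  child (supertile k N (p + ⌊ s + x /2⌋) (q + ⌊ t + y /2⌋)) (parity (s + x)) (parity (t + y))
    ≡⟨ cong (λ X → child X (parity (s + x)) (parity (t + y)))
         (entry-square (λ a b → supertile k N (p + a) (q + b)) (⌊s+a/2⌋≤1 s≤2 x≤1) (⌊s+a/2⌋≤1 t≤2 y≤1)) ⟨
  μ-grid (entry (quadAt k p q)) (s + x) (t + y) ∎
  where open ≡-Reasoning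

Legal-subquad : ∀ {sq s t} → Legal sq → s ≤ 2 → t ≤ 2 → Legal (subquad sq s t)
Legal-subquad legal s≤2 t≤2 with find legal
... | _ , pq∈ , refl =
  All.lookup (All.lookup legal-closure pq∈) (∈-cartesianProduct⁺ (∈-upTo⁺ (s≤s s≤2)) (∈-upTo⁺ (s≤s t≤2)))

quad-legal : ∀ k {p q} → Fits 2 2 (suc k) p q → Legal (quadAt (suc k) p q)
quad-legal zero    {zero}  {zero}  _ = legal-base
quad-legal zero    {suc p} {q}     (s≤s p+2≤1 , _) = ⊥-elim (1+n≰n (≤-trans (m≤n+m 2 p) p+2≤1))
quad-legal zero    {zero}  {suc q} (_ , s≤s q+2≤1) = ⊥-elim (1+n≰n (≤-trans (m≤n+m 2 q) q+2≤1))
quad-legal (suc k) {p} {q} (p+2≤ , q+2≤)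
  with split-into-blocks 2 (2 ^ suc k) ≤-refl 2≤2^[1+k] (subst (p + 2 ≤_) (*-comm 2 (2 ^ suc k)) p+2≤)
     | split-into-blocks 2 (2 ^ suc k) ≤-refl 2≤2^[1+k] (subst (q + 2 ≤_) (*-comm 2 (2 ^ suc k)) q+2≤)
  where 2≤2^[1+k] = ^-monoʳ-≤ 2 (s≤s (z≤n {k}))
... | p′ , s , refl , s+2≤4 , p′+2≤2^[1+k] | q′ , t , refl , t+2≤4 , q′+2≤2^[1+k] =
  subst Legal (sym (quadAt-μ (suc k) p′ q′ s≤2 t≤2))
    (Legal-subquad (quad-legal k (p′+2≤2^[1+k] , q′+2≤2^[1+k])) s≤2 t≤2)
  where s≤2 = +-cancelʳ-≤ 2 s 2 s+2≤4
        t≤2 = +-cancelʳ-≤ 2 t 2 t+2≤4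

quadAt-entry : ∀ {k k′ p q p′ q′ s t} → quadAt k p q ≡ quadAt k′ p′ q′ → s ≤ 1 → t ≤ 1 →
  supertile k N (p + s) (q + t) ≡ supertile k′ N (p′ + s) (q′ + t)
quadAt-entry {k} {k′} {p} {q} {p′} {q′} {s} {t} same s≤1 t≤1 = begin
  supertile k N (p + s) (q + t)     ≡⟨ entry-square (λ a b → supertile k N (p + a) (q + b)) s≤1 t≤1 ⟨
  entry (quadAt k p q) s t          ≡⟨ cong (λ sq → entry sq s t) same ⟩
  entry (quadAt k′ p′ q′) s t       ≡⟨ entry-square (λ a b → supertile k′ N (p′ + a) (q′ + b)) s≤1 t≤1 ⟩
  supertile k′ N (p′ + s) (q′ + t)  ∎
  where open ≡-Reasoning

window-in-blocks : ∀ j {k k′ p q p′ q′ u v m n} →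
  quadAt k p q ≡ quadAt k′ p′ q′ → u + m ≤ 2 * 2 ^ j → v + n ≤ 2 * 2 ^ j →
  window (supertile (j + k) N) (p * 2 ^ j + u) (q * 2 ^ j + v) m n ≡
  window (supertile (j + k′) N) (p′ * 2 ^ j + u) (q′ * 2 ^ j + v) m n
window-in-blocks j {k} {k′} {p} {q} {p′} {q′} {u} {v} {m} {n} same u+m≤ v+n≤ = table-cong m n λ {a} {b} a<m b<n →
  let s≤1 = s≤s⁻¹ (⌊u/2^j⌋<t j (<-≤-trans (+-monoʳ-< u a<m) u+m≤))
      t≤1 = s≤s⁻¹ (⌊u/2^j⌋<t j (<-≤-trans (+-monoʳ-< v b<n) v+n≤))
  in begin
  supertile (j + k) N (p * 2 ^ j + u + a) (q * 2 ^ j + v + b)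
    ≡⟨ cong₂ (supertile (j + k) N) (+-assoc (p * 2 ^ j) u a) (+-assoc (q * 2 ^ j) v b) ⟩
  supertile (j + k) N (p * 2 ^ j + (u + a)) (q * 2 ^ j + (v + b))
    ≡⟨ supertile-+ j k N p q (u + a) (v + b) ⟩
  supertile j (supertile k N (p + ⌊ u + a /2^ j ⌋) (q + ⌊ v + b /2^ j ⌋)) (u + a) (v + b)
    ≡⟨ cong (λ Y → supertile j Y (u + a) (v + b)) (quadAt-entry {k} {k′} {p} {q} {p′} {q′} same s≤1 t≤1) ⟩
  supertile j (supertile k′ N (p′ + ⌊ u + a /2^ j ⌋) (q′ + ⌊ v + b /2^ j ⌋)) (u + a) (v + b)
    ≡⟨ supertile-+ j k′ N p′ q′ (u + a) (v + b) ⟨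
  supertile (j + k′) N (p′ * 2 ^ j + (u + a)) (q′ * 2 ^ j + (v + b))
    ≡⟨ cong₂ (supertile (j + k′) N) (+-assoc (p′ * 2 ^ j) u a) (+-assoc (q′ * 2 ^ j) v b) ⟨
  supertile (j + k′) N (p′ * 2 ^ j + u + a) (q′ * 2 ^ j + v + b) ∎
  where open ≡-Reasoning

occurs-at-level-m+n+5 : ∀ {m n k r c} d → m + n + suc d ≡ k → Fits m n k r c →
  Σ ℕ λ r′ → Σ ℕ λ c′ →
    Fits m n (m + n + 5) r′ c′ × window (supertile (m + n + 5) N) r′ c′ m n ≡ window (supertile k N) r c m n
occurs-at-level-m+n+5 {m} {n} {r = r} {c} d refl (r+m≤ , c+n≤)
  with split-into-blocks (2 ^ (m + n)) (2 ^ suc d) m≤2^[m+n] 2≤2^[1+d] (subst (r + m ≤_) 2^[m+n+1+d] r+m≤)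
     | split-into-blocks (2 ^ (m + n)) (2 ^ suc d) n≤2^[m+n] 2≤2^[1+d] (subst (c + n ≤_) 2^[m+n+1+d] c+n≤)
  where
  m≤2^[m+n] = ≤-trans (<⇒≤ (n<2^n m)) (^-monoʳ-≤ 2 (m≤m+n m n))
  n≤2^[m+n] = ≤-trans (<⇒≤ (n<2^n n)) (^-monoʳ-≤ 2 (m≤n+m n m))
  2≤2^[1+d] = ^-monoʳ-≤ 2 (s≤s (z≤n {d}))
  2^[m+n+1+d] = trans (^-distribˡ-+-* 2 (m + n) (suc d)) (*-comm (2 ^ (m + n)) (2 ^ suc d))
... | p , u , refl , u+m≤ , p+2≤ | q , v , refl , v+n≤ , q+2≤ with find (quad-legal d (p+2≤ , q+2≤))
... | (p₀ , q₀) , site∈ , same with All.lookup sites-fit site∈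
... | p₀+2≤32 , q₀+2≤32 =
  p₀ * 2 ^ (m + n) + u , q₀ * 2 ^ (m + n) + v ,
  (block-fits (m + n) 5 p₀+2≤32 u+m≤ , block-fits (m + n) 5 q₀+2≤32 v+n≤) ,
  window-in-blocks (m + n) {5} {suc d} {p₀} {q₀} {p} {q} (sym same) u+m≤ v+n≤

bounded-level : ∀ {m n k r c} → Fits m n k r c →
  Σ ℕ λ k′ → Σ ℕ λ r′ → Σ ℕ λ c′ →
    k′ ≤ m + n + 5 × Fits m n k′ r′ c′ × window (supertile k′ N) r′ c′ m n ≡ window (supertile k N) r c m n
bounded-level {m} {n} {k} {r} {c} fits with k ≤? m + n + 5
... | yes k≤m+n+5 = k , r , c , k≤m+n+5 , fits , refl
... | no k≰m+n+5 =
  let d , 1+m+n+d≡k = m≤n⇒∃[o]m+o≡n (≤-<-trans (m≤m+n (m + n) 5) (≰⇒> k≰m+n+5))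
      r′ , c′ , fits′ , same = occurs-at-level-m+n+5 d (trans (+-suc (m + n) d) 1+m+n+d≡k) fits
  in  m + n + 5 , r′ , c′ , ≤-refl , fits′ , same

Window-finite : ∀ {i j m n} → i ≤ 1 → j ≤ 1 → Σ ℕ (HasCard (Window i j m n))
Window-finite {i} {j} {m} {n} i≤1 j≤1 = _ , HasCard-deduplicate windows (λ y → mk⇔ sound complete)
  where
  b = m + n + 5
  Fitting : ℕ × ℕ × ℕ → Set
  Fitting (k , r , c) = Fits m n k r c
  fits? : ∀ krc → Dec (Fitting krc)
  fits? (k , r , c) = (r + m ≤? 2 ^ k) ×-dec (c + n ≤? 2 ^ k)
  windowAt : ℕ × ℕ × ℕ → Matrix
  windowAt (k , r , c) = window (supertile (suc k) N) (r * 2 + i) (c * 2 + j) m n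
  positions : List (ℕ × ℕ × ℕ)
  positions = cartesianProduct (upTo (suc b)) (cartesianProduct (upTo (suc (2 ^ b))) (upTo (suc (2 ^ b))))
  windows : List Matrix
  windows = map windowAt (filter fits? positions)
  sound : ∀ {y} → y ∈ windows → Window i j m n y
  sound y∈ with ∈-map⁻ windowAt y∈
  ... | (k , r , c) , krc∈ , refl = k , r , c , proj₂ (∈-filter⁻ fits? {xs = positions} krc∈) , refl
  x≤2^b : ∀ {x l k} → x + l ≤ 2 ^ k → k ≤ b → x < suc (2 ^ b)
  x≤2^b {x} {l} x+l≤2^k k≤b = s≤s (≤-trans (m≤m+n x l) (≤-trans x+l≤2^k (^-monoʳ-≤ 2 k≤b)))
  complete : ∀ {y} → Window i j m n y → y ∈ windows
  complete (k , r , c , fits , refl) =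
    let k′ , r′ , c′ , k′≤b , fits′ , same = bounded-level {m} {n} {k} {r} {c} fits
    in  subst (_∈ windows) (window-μ-grid-cong {supertile k′ N} {supertile k N} {r′} {c′} {r} {c} i≤1 j≤1 same)
          (∈-map⁺ windowAt (∈-filter⁺ fits?
            (∈-cartesianProduct⁺ (∈-upTo⁺ (s≤s k′≤b))
              (∈-cartesianProduct⁺ (∈-upTo⁺ (x≤2^b (proj₁ fits′) k′≤b))
                                   (∈-upTo⁺ (x≤2^b (proj₂ fits′) k′≤b))))
            fits′))

Window⇒InPij : ∀ {i j m n κ} → i ≤ 1 → j ≤ 1 →
  HasCard (Window i j (suc m) (suc n)) κ → HasCard (InPij (suc i) (suc j) (suc m) (suc n)) κ
Window⇒InPij i≤1 j≤1 = HasCard-resp (Window⇔InPij i≤1 j≤1 (s≤s z≤n) (s≤s z≤n))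

0≤1 : 0 ≤ 1
0≤1 = z≤n

1≤1 : 1 ≤ 1
1≤1 = s≤s z≤n

2≤2+n : ∀ {n} → 2 ≤ 2 + n
2≤2+n = s≤s (s≤s z≤n)

part₁ : ∀ e → parity e ≡ 0ℙ → 4 ≤ e → SameCard (𝔞 1 2 e ∷ 𝔟 1 2 e ∷ 𝔟 2 2 (e ∸ 1) ∷ [])
part₁ e@(suc e′) even (s≤s (s≤s (s≤s (s≤s _)))) =
  let κ , b₁₂ = Window-finite {0} {1} {e} {suc e} 0≤1 1≤1
      a₁₂ = Window-dropColumn 0≤1 1≤1 2≤2+n (parity[1+n]≡1ℙ e even) b₁₂
      b₂₂ = Window-dropRow {1} {e′} {e} 1≤1 2≤2+n a₁₂
  in  κ , Window⇒InPij 0≤1 1≤1 a₁₂ ∷ Window⇒InPij 0≤1 1≤1 b₁₂ ∷ Window⇒InPij 1≤1 1≤1 b₂₂ ∷ []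

part₂ : ∀ e → parity e ≡ 0ℙ → 4 ≤ e → SameCard (𝔞 2 1 e ∷ 𝔠 1 1 e ∷ 𝔠 2 1 (e ∸ 1) ∷ [])
part₂ e@(suc e′) even (s≤s (s≤s (s≤s (s≤s _)))) =
  let κ , c₁₁ = Window-finite {0} {0} {suc e} {e} 0≤1 0≤1
      a₂₁ = Window-dropRow {0} {e} {e} 0≤1 2≤2+n c₁₁
      c₂₁ = Window-dropColumn {1} {0} {e} {e′} 1≤1 0≤1 2≤2+n (parity[n]≡1ℙ e′ even) a₂₁
  in  κ , Window⇒InPij 1≤1 0≤1 a₂₁ ∷ Window⇒InPij 0≤1 0≤1 c₁₁ ∷ Window⇒InPij 1≤1 0≤1 c₂₁ ∷ []

part₃ : ∀ e → parity e ≡ 0ℙ → 2 ≤ e → SameCard (𝔞 2 2 e ∷ 𝔞 1 2 (e + 1) ∷ 𝔠 1 2 e ∷ 𝔟 2 2 e ∷ [])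
part₃ e@(suc (suc _)) even _ rewrite +-comm e 1 =
  let κ , a₁₂ = Window-finite {0} {1} {suc e} {suc e} 0≤1 1≤1
      c₁₂ = Window-dropColumn {0} {1} {suc e} {e} 0≤1 1≤1 2≤2+n (parity[1+n]≡1ℙ e even) a₁₂
      a₂₂ = Window-dropRow {1} {e} {e} 1≤1 2≤2+n c₁₂
      b₂₂ = Window-dropRow {1} {e} {suc e} 1≤1 2≤2+n a₁₂
  in  κ , Window⇒InPij 1≤1 1≤1 a₂₂ ∷ Window⇒InPij 0≤1 1≤1 a₁₂
        ∷ Window⇒InPij 0≤1 1≤1 c₁₂ ∷ Window⇒InPij 1≤1 1≤1 b₂₂ ∷ []

part₄ : ∀ e → parity e ≡ 0ℙ → 2 ≤ e → SameCard (𝔞 1 1 (e + 1) ∷ 𝔟 1 1 (e + 1) ∷ 𝔟 2 1 e ∷ [])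
part₄ e@(suc (suc _)) even _ rewrite +-comm e 1 =
  let κ , b₁₁ = Window-finite {0} {0} {suc e} {2 + e} 0≤1 0≤1
      a₁₁ = Window-dropColumn {0} {0} {suc e} {suc e} 0≤1 0≤1 2≤2+n (parity[1+n]≡1ℙ e even) b₁₁
      b₂₁ = Window-dropRow {0} {e} {suc e} 0≤1 2≤2+n a₁₁
  in  κ , Window⇒InPij 0≤1 0≤1 a₁₁ ∷ Window⇒InPij 0≤1 0≤1 b₁₁ ∷ Window⇒InPij 1≤1 0≤1 b₂₁ ∷ []

part₅ : ∀ e → parity e ≡ 0ℙ → 2 ≤ e →
  SameCard (𝔞 2 1 (e + 1) ∷ 𝔞 1 1 (e + 2) ∷ 𝔟 2 1 (e + 1) ∷ 𝔠 1 1 (e + 1) ∷ [])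
part₅ e@(suc (suc _)) even _ rewrite +-comm e 1 | +-comm e 2 =
  let κ , a₁₁ = Window-finite {0} {0} {2 + e} {2 + e} 0≤1 0≤1
      c₁₁ = Window-dropColumn {0} {0} {2 + e} {suc e} 0≤1 0≤1 2≤2+n (parity[1+n]≡1ℙ e even) a₁₁
      a₂₁ = Window-dropRow {0} {suc e} {suc e} 0≤1 2≤2+n c₁₁
      b₂₁ = Window-dropRow {0} {suc e} {2 + e} 0≤1 2≤2+n a₁₁
  in  κ , Window⇒InPij 1≤1 0≤1 a₂₁ ∷ Window⇒InPij 0≤1 0≤1 a₁₁
        ∷ Window⇒InPij 1≤1 0≤1 b₂₁ ∷ Window⇒InPij 0≤1 0≤1 c₁₁ ∷ []

part₆ : ∀ e → parity e ≡ 0ℙ → 2 ≤ e → SameCard (𝔞 2 2 (e + 1) ∷ 𝔠 1 2 (e + 1) ∷ 𝔠 2 2 e ∷ [])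
part₆ e@(suc (suc _)) even _ rewrite +-comm e 1 =
  let κ , c₁₂ = Window-finite {0} {1} {2 + e} {suc e} 0≤1 1≤1
      a₂₂ = Window-dropRow {1} {suc e} {suc e} 1≤1 2≤2+n c₁₂
      c₂₂ = Window-dropColumn {1} {1} {suc e} {e} 1≤1 1≤1 2≤2+n (parity[1+n]≡1ℙ e even) a₂₂
  in  κ , Window⇒InPij 1≤1 1≤1 a₂₂ ∷ Window⇒InPij 0≤1 1≤1 c₁₂ ∷ Window⇒InPij 1≤1 1≤1 c₂₂ ∷ []

lemma7 : (n : ℕ) → 2 ≤ n →
    SameCard (𝔞 1 2 (2 * n) ∷ 𝔟 1 2 (2 * n) ∷ 𝔟 2 2 (2 * n ∸ 1) ∷ [])
    × SameCard (𝔞 2 1 (2 * n) ∷ 𝔠 1 1 (2 * n) ∷ 𝔠 2 1 (2 * n ∸ 1) ∷ [])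
    × SameCard (𝔞 2 2 (2 * n) ∷ 𝔞 1 2 (2 * n + 1) ∷ 𝔠 1 2 (2 * n) ∷ 𝔟 2 2 (2 * n) ∷ [])
    × SameCard (𝔞 1 1 (2 * n + 1) ∷ 𝔟 1 1 (2 * n + 1) ∷ 𝔟 2 1 (2 * n) ∷ [])
    × SameCard (𝔞 2 1 (2 * n + 1) ∷ 𝔞 1 1 (2 * n + 2) ∷ 𝔟 2 1 (2 * n + 1) ∷ 𝔠 1 1 (2 * n + 1) ∷ [])
    × SameCard (𝔞 2 2 (2 * n + 1) ∷ 𝔠 1 2 (2 * n + 1) ∷ 𝔠 2 2 (2 * n) ∷ [])
lemma7 n 2≤n =
  part₁ (2 * n) even 4≤2n , part₂ (2 * n) even 4≤2n , part₃ (2 * n) even 2≤2n ,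
  part₄ (2 * n) even 2≤2n , part₅ (2 * n) even 2≤2n , part₆ (2 * n) even 2≤2n
  where
  even : parity (2 * n) ≡ 0ℙ
  even = *-homo-* 2 n
  4≤2n : 4 ≤ 2 * n
  4≤2n = *-monoʳ-≤ 2 2≤n
  2≤2n : 2 ≤ 2 * n
  2≤2n = ≤-trans (m≤m+n 2 2) 4≤2n
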